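{- Let $T$ be a finite tree, let $v \in Core(T)$, and let $u$ be a neighbor of $v$. Let $T_v$ (resp. $T_u$) be the component of $T-uv$ containing $v$ (resp. $u$). Then $$ F_{T_v}(v) \geq F_{T_u}(u), $$ with equality if and only if $u \in Core(T)$.
   Context: For a tree $T$ and a vertex $v$, $F_T(v)$ denotes the number of subtrees of $T$ (connected subgraphs, i.e. subtrees, of $T$) containing $v$. The subtree core $Core(T)$ is the set of vertices of $T$ maximizing $F_T(\cdot)$. -}

module Defs where

open import Data.Nat using (ℕ; _≤_)
open import Data.Bool using (Bool; true)
open import Data.Fin using (Fin)
open import Data.Fin.Subset using (Subset; _∈_; _⊆_)
open import Data.List using (List; []; _∷_; _++_; [_]; length)
open import Data.List.Relation.Unary.Linked using (Linked)
open import Data.List.Relation.Unary.Unique.Propositional using (Unique)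
import Data.List.Membership.Propositional as LMem
open import Data.Product using (Σ; _×_; ∃)
open import Data.Empty using (⊥)
open import Function.Bundles using (_⇔_)
open import Relation.Nullary using (¬_; Dec; yes; no)
open import Relation.Nullary.Decidable using (_×-dec_; ¬?)
import Data.Fin.Properties as FinP
open import Relation.Binary.PropositionalEquality using (_≡_)

record Graph (n : ℕ) : Set₁ where
  field
    Adj     : Fin n → Fin n → Set
    sym     : ∀ {x y} → Adj x y → Adj y x
    irrefl  : ∀ {x} → ¬ Adj x x
    dec     : ∀ x y → Dec (Adj x y)

open Graph public

data WalkIn {n : ℕ} (G : Graph n) (P : Fin n → Set) : Fin n → Fin n → Set where
  here : ∀ {x} → P x → WalkIn G P x x
  step : ∀ {x y z} → P x → Adj G x y → WalkIn G P y z → WalkIn G P x z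

Everywhere : ∀ {n} → Fin n → Set
Everywhere _ = Data.Unit.⊤
  where import Data.Unit

Connected : ∀ {n} → Graph n → Set
Connected G = ∀ x y → WalkIn G Everywhere x y

HasCycle : ∀ {n} → Graph n → Set
HasCycle {n} G = Σ (Fin n) λ x → Σ (List (Fin n)) λ ys →
  2 ≤ length ys × Unique (x ∷ ys) × Linked (Adj G) (x ∷ ys ++ [ x ])

record Tree (n : ℕ) : Set₁ where
  field
    graph     : Graph n
    connected : Connected graph
    acyclic   : ¬ HasCycle graph

open Tree public

InducesConnected : ∀ {n} → Graph n → Subset n → Set
InducesConnected G S = ∀ x y → x ∈ S → y ∈ S → WalkIn G (_∈ S) x y

-- "Exactly k vertex subsets satisfy Q": a duplicate-free list of subsets
-- whose members are exactly those satisfying Q, of length k.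
module _ {n : ℕ} where
  open LMem using () renaming (_∈_ to _∈ₗ_)
  CountIs : (Subset n → Set) → ℕ → Set
  CountIs Q k = Σ (List (Subset n)) λ xs →
    Unique xs × (∀ S → (S ∈ₗ xs) ⇔ Q S) × length xs ≡ k

-- Subtrees of the graph G restricted to vertex set C (a component), containing v:
-- vertex subsets S ⊆ C with v ∈ S, inducing a connected subgraph.
-- F G C v k  means  F_{G[C]}(v) = k.
F : ∀ {n} → Graph n → Subset n → Fin n → ℕ → Set
F G C v k = CountIs (λ S → S ⊆ C × v ∈ S × InducesConnected G S) k

Full : ∀ {n} → Subset n
Full = Data.Fin.Subset.⊤
  where import Data.Fin.Subset

FT : ∀ {n} → Tree n → Fin n → ℕ → Set
FT T v k = F (graph T) Full v k

InCore : ∀ {n} → Tree n → Fin n → Set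
InCore T v = ∀ w a b → FT T v a → FT T w b → b ≤ a

RemoveEdge : ∀ {n} → Graph n → Fin n → Fin n → Graph n
RemoveEdge G u v = record
  { Adj    = λ x y → Adj G x y × ¬ (x ≡ u × y ≡ v) × ¬ (x ≡ v × y ≡ u)
  ; sym    = λ { (a , p , q) → sym G a , (λ { (e1 , e2) → q (e2 , e1) }) , (λ { (e1 , e2) → p (e2 , e1) }) }
  ; irrefl = λ { (a , _) → irrefl G a }
  ; dec    = λ x y → dec G x y ×-dec (¬? ((x FinP.≟ u) ×-dec (y FinP.≟ v)) ×-dec ¬? ((x FinP.≟ v) ×-dec (y FinP.≟ u)))
  }
  where open Data.Product using (_,_)

Component : ∀ {n} → Graph n → Fin n → Subset n → Set
Component G v C = ∀ w → (w ∈ C) ⇔ WalkIn G Everywhere v w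

-- A subtree of T
-- containing v either avoids u, and is then a subtree of T_v containing v, or it contains
-- u, and is then the union of such a subtree with a subtree of T_u containing u; both
-- pieces are recovered by intersecting with the components. Writing a = F_{T_v}(v) and
-- b = F_{T_u}(u), this gives F_T(v) = a + ab and F_T(u) = b + ab. So F_T(u) ≤ F_T(v),
-- which holds as v is in the core, says b ≤ a, and F_T(u) = F_T(v) says a = b.
module Submission where

open import Defs
open import Data.Nat using (ℕ; _≤_; _+_; _*_; s≤s; z≤n)
open import Data.Nat.Properties using (≤-antisym; +-cancelʳ-≤; *-comm)
open import Data.Fin using (Fin)
open import Data.Fin.Properties using (_≟_)
open import Data.Fin.Subset using (Subset; _∈_; _∉_; _⊆_; _∩_; _∪_; ⊤)
open import Data.Fin.Subset.Properties
  using (_∈?_; ∈⊤; ⊆⊤; ⊆-antisym; x∈p∩q⁺; x∈p∩q⁻; x∈p∪q⁺; x∈p∪q⁻; ∪-comm; ∩-identityʳ; ∩-distribˡ-∪)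
open import Data.Product using (_×_; _,_; proj₁; proj₂; ∃; ∃₂; <_,_>; uncurry)
open import Data.Product.Properties using (×-≡,≡→≡)
open import Data.Sum using (_⊎_; inj₁; inj₂)
import Data.Sum as Sum
open import Data.Sum.Function.Propositional using (_⊎-cong_)
open import Data.Unit using (tt)
open import Data.Empty using (⊥-elim)
open import Data.List using (List; []; _∷_; _++_; [_]; length; map; cartesianProduct)
open import Data.List.Properties using (length-++; length-map; map-∘; map-id-local)
open import Data.List.Relation.Unary.All as All using (All; [])
open import Data.List.Relation.Unary.All.Properties using (¬Any⇒All¬)
open import Data.List.Relation.Unary.Any using (here; there; any?)
open import Data.List.Relation.Unary.AllPairs using ([]; _∷_)
open import Data.List.Relation.Unary.Linked using (Linked; [-]; _∷_)
open import Data.List.Relation.Unary.Unique.Propositional using (Unique)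
open import Data.List.Relation.Unary.Unique.Propositional.Properties
  using (map⁻; ++⁺; cartesianProduct⁺)
open import Data.List.Membership.Propositional using () renaming (_∈_ to _∈ₗ_)
open import Data.List.Membership.Propositional.Properties
  using (++-∈⇔; ∈-map⁺; ∈-map⁻; ∈-cartesianProduct⁺; ∈-cartesianProduct⁻)
open import Data.List.Membership.Propositional.Properties.WithK using (unique∧set⇒bag)
open import Data.List.Relation.Binary.BagAndSetEquality using (∼bag⇒↭)
open import Data.List.Relation.Binary.Permutation.Propositional.Properties using (↭-length)
open import Function using (_∘_)
open import Function.Bundles using (_⇔_; mk⇔; Equivalence)
import Function.Properties.Equivalence as ⇔
open import Relation.Nullary using (¬_; yes; no; _×-dec_)
open import Relation.Binary.PropositionalEquality as ≡ using (_≡_; _≢_; refl; cong; cong₂; subst)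
open ≡.≡-Reasoning

open Equivalence using (to; from)

private variable
  n : ℕ

m+m*n≤n+n*m⇒m≤n : ∀ m n → m + m * n ≤ n + n * m → m ≤ n
m+m*n≤n+n*m⇒m≤n m n le = +-cancelʳ-≤ (n * m) m n (subst (λ k → m + k ≤ n + n * m) (*-comm m n) le)

length-cartesianProduct : ∀ {A B : Set} (xs : List A) (ys : List B) →
  length (cartesianProduct xs ys) ≡ length xs * length ys
length-cartesianProduct []       ys = refl
length-cartesianProduct (x ∷ xs) ys = begin
  length (map (x ,_) ys ++ cartesianProduct xs ys)         ≡⟨ length-++ (map (x ,_) ys) ⟩
  length (map (x ,_) ys) + length (cartesianProduct xs ys) ≡⟨ cong₂ _+_ (length-map (x ,_) ys)
                                                                        (length-cartesianProduct xs ys) ⟩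
  length ys + length xs * length ys                        ∎

Unique-map⁺-retract : ∀ {A B : Set} {f : A → B} (r : B → A) {xs : List A} →
  All (λ x → r (f x) ≡ x) xs → Unique xs → Unique (map f xs)
Unique-map⁺-retract {f = f} r {xs} r∘f≗id !xs =
  map⁻ (subst Unique (≡.sym (≡.trans (≡.sym (map-∘ {g = r} {f = f} xs)) (map-id-local r∘f≗id))) !xs)

∪-∩-cancel : {S R C : Subset n} → S ⊆ C → (∀ {x} → x ∈ R → x ∉ C) → (S ∪ R) ∩ C ≡ S
∪-∩-cancel {S = S} {R} {C} S⊆C R∩C≡∅ =
  ⊆-antisym ⊆S (λ x∈S → x∈p∩q⁺ (x∈p∪q⁺ (inj₁ x∈S) , S⊆C x∈S))
  where
  ⊆S : (S ∪ R) ∩ C ⊆ S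
  ⊆S x∈ with x∈p∩q⁻ (S ∪ R) C x∈
  ... | x∈S∪R , x∈C with x∈p∪q⁻ S R x∈S∪R
  ...   | inj₁ x∈S = x∈S
  ...   | inj₂ x∈R = ⊥-elim (R∩C≡∅ x∈R x∈C)

∩-split : {A B : Subset n} → (∀ x → x ∈ A ⊎ x ∈ B) → ∀ S → S ≡ (S ∩ A) ∪ (S ∩ B)
∩-split {A = A} {B} cover S = begin
  S               ≡⟨ ≡.sym (∩-identityʳ S) ⟩
  S ∩ ⊤           ≡⟨ cong (S ∩_) (⊆-antisym (λ _ → x∈p∪q⁺ (cover _)) ⊆⊤) ⟩
  S ∩ (A ∪ B)     ≡⟨ ∩-distribˡ-∪ S A B ⟩
  S ∩ A ∪ S ∩ B   ∎

CountIs-unique : {Q : Subset n → Set} {k k' : ℕ} → CountIs Q k → CountIs Q k' → k ≡ k'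
CountIs-unique (xs , !xs , xs⇔ , refl) (ys , !ys , ys⇔ , refl) =
  ↭-length (∼bag⇒↭ (unique∧set⇒bag !xs !ys (λ {S} → ⇔.trans (xs⇔ S) (⇔.sym (ys⇔ S)))))

module _ {P Q : Subset n → Set} where

  CountIs-resp : (∀ S → P S ⇔ Q S) → ∀ {k} → CountIs P k → CountIs Q k
  CountIs-resp P⇔Q (xs , !xs , xs⇔ , |xs|) = xs , !xs , (λ S → ⇔.trans (xs⇔ S) (P⇔Q S)) , |xs|

  CountIs-⊎ : ∀ {a b} → CountIs P a → CountIs Q b → (∀ {S} → P S → ¬ Q S) →
    CountIs (λ S → P S ⊎ Q S) (a + b)
  CountIs-⊎ (xs , !xs , xs⇔ , refl) (ys , !ys , ys⇔ , refl) P∩Q≡∅ =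
    xs ++ ys ,
    ++⁺ !xs !ys (λ (S∈xs , S∈ys) → P∩Q≡∅ (to (xs⇔ _) S∈xs) (to (ys⇔ _) S∈ys)) ,
    (λ S → ⇔.trans ++-∈⇔ (xs⇔ S ⊎-cong ys⇔ S)) ,
    length-++ xs

  CountIs-image₂ : (f : Subset n → Subset n → Subset n) (g h : Subset n → Subset n) →
    (∀ {S R} → P S → Q R → g (f S R) ≡ S × h (f S R) ≡ R) →
    ∀ {a b} → CountIs P a → CountIs Q b →
    CountIs (λ Z → ∃₂ λ S R → P S × Q R × Z ≡ f S R) (a * b)
  CountIs-image₂ f g h recover (xs , !xs , xs⇔ , refl) (ys , !ys , ys⇔ , refl) =
    map (uncurry f) pairs , !image , image⇔ , |image|
    where
    pairs : List (Subset n × Subset n)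
    pairs = cartesianProduct xs ys

    components : ∀ {SR} → SR ∈ₗ pairs → P (proj₁ SR) × Q (proj₂ SR)
    components SR∈ with S∈ , R∈ ← ∈-cartesianProduct⁻ xs ys SR∈ = to (xs⇔ _) S∈ , to (ys⇔ _) R∈

    !image : Unique (map (uncurry f) pairs)
    !image = Unique-map⁺-retract < g , h >
      (All.tabulate (λ SR∈ → ×-≡,≡→≡ (uncurry recover (components SR∈))))
      (cartesianProduct⁺ !xs !ys)

    image⇔ : ∀ Z → (Z ∈ₗ map (uncurry f) pairs) ⇔ (∃₂ λ S R → P S × Q R × Z ≡ f S R)
    image⇔ Z = mk⇔ toImage fromImage
      where
      toImage : Z ∈ₗ map (uncurry f) pairs → ∃₂ λ S R → P S × Q R × Z ≡ f S R
      toImage Z∈ with (S , R) , SR∈ , refl ← ∈-map⁻ (uncurry f) Z∈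
        = S , R , proj₁ (components SR∈) , proj₂ (components SR∈) , refl
      fromImage : (∃₂ λ S R → P S × Q R × Z ≡ f S R) → Z ∈ₗ map (uncurry f) pairs
      fromImage (S , R , PS , QR , refl) =
        ∈-map⁺ (uncurry f) (∈-cartesianProduct⁺ (from (xs⇔ S) PS) (from (ys⇔ R) QR))

    |image| : length (map (uncurry f) pairs) ≡ length xs * length ys
    |image| = ≡.trans (length-map (uncurry f) pairs) (length-cartesianProduct xs ys)

Subtree : Graph n → Subset n → Fin n → Subset n → Set
Subtree G C r S = S ⊆ C × r ∈ S × InducesConnected G S

_⊆ᴬ_ : Graph n → Graph n → Set
G ⊆ᴬ H = ∀ {x y} → Adj G x y → Adj H x y

module _ {n : ℕ} where

  private variable
    G H : Graph n
    P Q : Fin n → Set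
    x y z w : Fin n
    l : List (Fin n)

  mapᵂ : G ⊆ᴬ H → (∀ {a} → P a → Q a) → WalkIn G P x y → WalkIn H Q x y
  mapᵂ f g (here px)     = here (g px)
  mapᵂ f g (step px a w) = step (g px) (f a) (mapᵂ f g w)

  unrestrict : WalkIn G P x y → WalkIn G Everywhere x y
  unrestrict = mapᵂ (λ a → a) (λ _ → tt)

  headᵂ : WalkIn G P x y → P x
  headᵂ (here px)     = px
  headᵂ (step px _ _) = px

  _++ᵂ_ : WalkIn G P x y → WalkIn G P y z → WalkIn G P x z
  here _       ++ᵂ w' = w'
  step px a w ++ᵂ w' = step px a (w ++ᵂ w')

  reverseᵂ : WalkIn G P x y → WalkIn G P y x
  reverseᵂ         (here px)     = here px
  reverseᵂ {G = G} (step px a w) = reverseᵂ w ++ᵂ step (headᵂ w) (sym G a) (here px)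

  InducesConnected-fromRoot : ∀ {S} r → (∀ x → x ∈ S → WalkIn G (_∈ S) x r) → InducesConnected G S
  InducesConnected-fromRoot r toRoot x y x∈S y∈S = toRoot x x∈S ++ᵂ reverseᵂ (toRoot y y∈S)

  data Path (G : Graph n) : Fin n → Fin n → List (Fin n) → Set where
    stop : Path G x x [ x ]
    _∷ᵖ_ : Adj G x y → Path G y z l → Path G x z (x ∷ l)

  Path-suffix : Path G y z l → x ∈ₗ l → Unique l → ∃ λ l' → Path G x z l' × Unique l'
  Path-suffix stop     (here refl) !l       = _ , stop , !l
  Path-suffix (a ∷ᵖ p) (here refl) !l       = _ , a ∷ᵖ p , !l
  Path-suffix (_ ∷ᵖ p) (there x∈l) (_ ∷ !l) = Path-suffix p x∈l !l

  loopErase : WalkIn G P x z → ∃ λ l → Path G x z l × Unique l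
  loopErase (here _) = _ , stop , ([] ∷ [])
  loopErase {x = x} (step _ a w) with l , p , !l ← loopErase w | any? (x ≟_) l
  ... | yes x∈l = Path-suffix p x∈l !l
  ... | no  x∉l = x ∷ l , a ∷ᵖ p , ¬Any⇒All¬ l x∉l ∷ !l

  Path⇒Linked-snoc : G ⊆ᴬ H → Path G x z l → Adj H z w → Linked (Adj H) (l ++ [ w ])
  Path⇒Linked-snoc                 f stop               e = e ∷ [-]
  Path⇒Linked-snoc                 f (a ∷ᵖ stop)        e = f a ∷ e ∷ [-]
  Path⇒Linked-snoc {G = G} {H} f (a ∷ᵖ (a' ∷ᵖ p)) e =
    f a ∷ Path⇒Linked-snoc {G = G} {H} f (a' ∷ᵖ p) e

  2≤length : Adj G x y → Path G y z l → 2 ≤ length (x ∷ l)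
  2≤length _ stop     = s≤s (s≤s z≤n)
  2≤length _ (_ ∷ᵖ _) = s≤s (s≤s z≤n)

  -- The hypothesis ¬ Adj G x z rules out the two-vertex "cycle" x z x.
  Path+edge⇒cycle : G ⊆ᴬ H → Path G x z l → Unique l → Adj H z x → ¬ Adj G x z → HasCycle H
  Path+edge⇒cycle {H = H} f stop        _ e _   = ⊥-elim (irrefl H e)
  Path+edge⇒cycle          f (a ∷ᵖ stop) _ _ ¬xz = ⊥-elim (¬xz a)
  Path+edge⇒cycle {G = G} {H} f p@(a ∷ᵖ (a' ∷ᵖ p')) !l e _ =
    _ , _ , 2≤length a' p' , !l , Path⇒Linked-snoc {G = G} {H} f p e

record EdgeDeleted (G G' : Graph n) (p q : Fin n) : Set where
  field
    edge  : Adj G p q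
    kept  : G' ⊆ᴬ G
    split : ∀ {x y} → Adj G x y → Adj G' x y ⊎ ((x ≡ p × y ≡ q) ⊎ (x ≡ q × y ≡ p))
    cut   : ¬ Adj G' p q

RemoveEdge-deletes : (G : Graph n) {u v : Fin n} → Adj G u v → EdgeDeleted G (RemoveEdge G u v) u v
RemoveEdge-deletes G {u} {v} uv = record
  { edge  = uv
  ; kept  = proj₁
  ; split = split
  ; cut   = λ (_ , ¬uv , _) → ¬uv (refl , refl)
  }
  where
  split : ∀ {x y} → Adj G x y →
    Adj (RemoveEdge G u v) x y ⊎ ((x ≡ u × y ≡ v) ⊎ (x ≡ v × y ≡ u))
  split {x} {y} xy with (x ≟ u) ×-dec (y ≟ v) | (x ≟ v) ×-dec (y ≟ u)
  ... | yes xy≡uv | _          = inj₂ (inj₁ xy≡uv)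
  ... | no _      | yes xy≡vu = inj₂ (inj₂ xy≡vu)
  ... | no xy≢uv  | no xy≢vu  = inj₁ (xy , xy≢uv , xy≢vu)

EdgeDeleted-sym : {G G' : Graph n} {p q : Fin n} → EdgeDeleted G G' p q → EdgeDeleted G G' q p
EdgeDeleted-sym {G = G} {G'} del = record
  { edge  = sym G edge
  ; kept  = kept
  ; split = Sum.map₂ Sum.swap ∘ split
  ; cut   = cut ∘ sym G'
  }
  where open EdgeDeleted del

acyclic⇒bridge : {G G' : Graph n} {p q : Fin n} →
  ¬ HasCycle G → EdgeDeleted G G' p q → ¬ WalkIn G' Everywhere p q
acyclic⇒bridge {G = G} {G'} acyclic del w with _ , path , !l ← loopErase w =
  acyclic (Path+edge⇒cycle {G = G'} {G} kept path !l (sym G edge) cut)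
  where open EdgeDeleted del

module _ {G G' : Graph n} {p q : Fin n} (del : EdgeDeleted G G' p q) where
  open EdgeDeleted del

  private variable
    P : Fin n → Set
    x y : Fin n

  firstCrossing : WalkIn G P x y → WalkIn G' P x y ⊎ (WalkIn G' P x p ⊎ WalkIn G' P x q)
  firstCrossing (here px) = inj₁ (here px)
  firstCrossing (step px a w) with split a
  ... | inj₂ (inj₁ (refl , refl)) = inj₂ (inj₁ (here px))
  ... | inj₂ (inj₂ (refl , refl)) = inj₂ (inj₂ (here px))
  ... | inj₁ a' = Sum.map (step px a') (Sum.map (step px a') (step px a')) (firstCrossing w)

  avoiding : (∀ {z} → P z → z ≢ q) → WalkIn G P x y → WalkIn G' P x y
  avoiding ≢q (here px) = here px
  avoiding ≢q (step px a w) with split a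
  ... | inj₁ a'                   = step px a' (avoiding ≢q w)
  ... | inj₂ (inj₁ (refl , refl)) = ⊥-elim (≢q (headᵂ w) refl)
  ... | inj₂ (inj₂ (refl , refl)) = ⊥-elim (≢q px refl)

module Side {G G' : Graph n} {p q : Fin n} (del : EdgeDeleted G G' p q)
  (bridge : ¬ WalkIn G' Everywhere p q) {C : Subset n} (comp : Component G' p C) where

  private variable
    P : Fin n → Set
    x y : Fin n
    S : Subset n

  reach⇒∈ : WalkIn G' Everywhere p x → x ∈ C
  reach⇒∈ = from (comp _)

  ∈⇒reach : x ∈ C → WalkIn G' Everywhere p x
  ∈⇒reach = to (comp _)

  p∈C : p ∈ C
  p∈C = reach⇒∈ (here tt)

  q∉C : q ∉ C
  q∉C = bridge ∘ ∈⇒reach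

  -- The part of the walk before it first crosses the deleted edge stays in C, so it cannot end at q.
  toRoot : x ∈ C → WalkIn G P x p → WalkIn G' P x p
  toRoot x∈C w with firstCrossing del w
  ... | inj₁ w'        = w'
  ... | inj₂ (inj₁ w') = w'
  ... | inj₂ (inj₂ w') = ⊥-elim (q∉C (reach⇒∈ (∈⇒reach x∈C ++ᵂ unrestrict w')))

  within : x ∈ C → WalkIn G' (_∈ S) x y → WalkIn G' (_∈ S ∩ C) x y
  within x∈C (here x∈S) = here (x∈p∩q⁺ (x∈S , x∈C))
  within x∈C (step x∈S a w) =
    step (x∈p∩q⁺ (x∈S , x∈C)) a (within (reach⇒∈ (∈⇒reach x∈C ++ᵂ step tt a (here tt))) w)

  restrict : Subtree G ⊤ p S → Subtree G' C p (S ∩ C)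
  restrict {S} (_ , p∈S , connS) =
    proj₂ ∘ x∈p∩q⁻ S C , x∈p∩q⁺ (p∈S , p∈C) , InducesConnected-fromRoot p toRoot'
    where
    toRoot' : ∀ x → x ∈ S ∩ C → WalkIn G' (_∈ S ∩ C) x p
    toRoot' x x∈ with x∈S , x∈C ← x∈p∩q⁻ S C x∈ = within x∈C (toRoot x∈C (connS x p x∈S p∈S))

  avoiding-q : q ∉ S → Subtree G ⊤ p S → Subtree G' C p S
  avoiding-q {S} q∉S (_ , p∈S , connS) =
    S⊆C , p∈S , λ x y x∈S y∈S → avoiding del ≢q (connS x y x∈S y∈S)
    where
    ≢q : ∀ {z} → z ∈ S → z ≢ q
    ≢q z∈S refl = q∉S z∈S
    S⊆C : S ⊆ C
    S⊆C x∈S = reach⇒∈ (unrestrict (avoiding del ≢q (connS _ _ p∈S x∈S)))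

module Bridge {G G' : Graph n} {p q : Fin n} (del : EdgeDeleted G G' p q) (conn : Connected G)
  (bridge : ¬ WalkIn G' Everywhere p q) {Cp Cq : Subset n}
  (compP : Component G' p Cp) (compQ : Component G' q Cq) where

  open EdgeDeleted del
  private
    module P = Side del bridge compP
    module Q = Side (EdgeDeleted-sym del) (bridge ∘ reverseᵂ) compQ

  private variable
    x : Fin n
    S R Z : Subset n

  disjoint : x ∈ Cq → x ∉ Cp
  disjoint x∈Cq x∈Cp = bridge (P.∈⇒reach x∈Cp ++ᵂ reverseᵂ (Q.∈⇒reach x∈Cq))

  cover : ∀ x → x ∈ Cp ⊎ x ∈ Cq
  cover x with firstCrossing del (conn x p)
  ... | inj₁ w        = inj₁ (P.reach⇒∈ (reverseᵂ w))
  ... | inj₂ (inj₁ w) = inj₁ (P.reach⇒∈ (reverseᵂ w))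
  ... | inj₂ (inj₂ w) = inj₂ (Q.reach⇒∈ (reverseᵂ w))

  lift : ∀ {C r} → Subtree G' C r S → Subtree G ⊤ r S
  lift (_ , r∈S , connS) =
    (λ _ → ∈⊤) , r∈S , λ x y x∈S y∈S → mapᵂ kept (λ z → z) (connS x y x∈S y∈S)

  union : Subtree G' Cp p S → Subtree G' Cq q R → Subtree G ⊤ p (S ∪ R)
  union {S} {R} (_ , p∈S , connS) (_ , q∈R , connR) =
    (λ _ → ∈⊤) , x∈p∪q⁺ (inj₁ p∈S) , InducesConnected-fromRoot p toRoot
    where
    toRoot : ∀ x → x ∈ S ∪ R → WalkIn G (_∈ S ∪ R) x p
    toRoot x x∈ with x∈p∪q⁻ S R x∈
    ... | inj₁ x∈S = mapᵂ kept (x∈p∪q⁺ ∘ inj₁) (connS x p x∈S p∈S)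
    ... | inj₂ x∈R = mapᵂ kept (x∈p∪q⁺ ∘ inj₂) (connR x q x∈R q∈R)
                     ++ᵂ step (x∈p∪q⁺ (inj₂ q∈R)) (sym G edge) (here (x∈p∪q⁺ (inj₁ p∈S)))

  recover : Subtree G' Cp p S → Subtree G' Cq q R → (S ∪ R) ∩ Cp ≡ S × (S ∪ R) ∩ Cq ≡ R
  recover {S} {R} (S⊆Cp , _) (R⊆Cq , _) =
    ∪-∩-cancel S⊆Cp (disjoint ∘ R⊆Cq) ,
    ≡.trans (cong (_∩ Cq) (∪-comm S R)) (∪-∩-cancel R⊆Cq (λ x∈S x∈Cq → disjoint x∈Cq (S⊆Cp x∈S)))

  Pieces : Subset n → Set
  Pieces Z = ∃₂ λ S R → Subtree G' Cp p S × Subtree G' Cq q R × Z ≡ S ∪ R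

  decompose : Subtree G ⊤ p Z → Subtree G' Cp p Z ⊎ Pieces Z
  decompose {Z} st@(_ , p∈Z , connZ) with q ∈? Z
  ... | no  q∉Z = inj₁ (P.avoiding-q q∉Z st)
  ... | yes q∈Z =
    inj₂ (Z ∩ Cp , Z ∩ Cq , P.restrict st , Q.restrict (⊆⊤ , q∈Z , connZ) , ∩-split cover Z)

  compose : Subtree G' Cp p Z ⊎ Pieces Z → Subtree G ⊤ p Z
  compose (inj₁ st)                         = lift st
  compose (inj₂ (_ , _ , stS , stR , refl)) = union stS stR

  Subtree⇒¬Pieces : Subtree G' Cp p S → ¬ Pieces S
  Subtree⇒¬Pieces (S⊆Cp , _) (_ , _ , _ , (_ , q∈R , _) , refl) = P.q∉C (S⊆Cp (x∈p∪q⁺ (inj₂ q∈R)))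

  F-across-bridge : ∀ {a b} → F G' Cp p a → F G' Cq q b → F G ⊤ p (a + a * b)
  F-across-bridge Fp Fq =
    CountIs-resp (λ Z → mk⇔ compose decompose)
      (CountIs-⊎ Fp (CountIs-image₂ _∪_ (_∩ Cp) (_∩ Cq) recover Fp Fq) Subtree⇒¬Pieces)

proposition2p2 : ∀ {n} (T : Tree n) (v u : Fin n) → InCore T v → Adj (graph T) v u →
    (Cv Cu : Subset n) →
    Component (RemoveEdge (graph T) u v) v Cv →
    Component (RemoveEdge (graph T) u v) u Cu →
    ∀ a b → F (RemoveEdge (graph T) u v) Cv v a → F (RemoveEdge (graph T) u v) Cu u b →
    b ≤ a × ((a ≡ b) ⇔ InCore T u)
proposition2p2 T v u v∈core vu Cv Cu compV compU a b Fv Fu = b≤a , mk⇔ a≡b⇒u∈core u∈core⇒a≡b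
  where
  deleted-u : EdgeDeleted (graph T) (RemoveEdge (graph T) u v) u v
  deleted-u = RemoveEdge-deletes (graph T) (sym (graph T) vu)
  deleted-v : EdgeDeleted (graph T) (RemoveEdge (graph T) u v) v u
  deleted-v = EdgeDeleted-sym deleted-u

  FT-v : FT T v (a + a * b)
  FT-v = Bridge.F-across-bridge deleted-v (connected T) (acyclic⇒bridge (acyclic T) deleted-v)
           compV compU Fv Fu

  FT-u : FT T u (b + b * a)
  FT-u = Bridge.F-across-bridge deleted-u (connected T) (acyclic⇒bridge (acyclic T) deleted-u)
           compU compV Fu Fv

  b≤a : b ≤ a
  b≤a = m+m*n≤n+n*m⇒m≤n b a (v∈core u _ _ FT-v FT-u)

  a≡b⇒u∈core : a ≡ b → InCore T u
  a≡b⇒u∈core refl w c d FT-u' FT-w =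
    subst (d ≤_) (CountIs-unique FT-u FT-u') (v∈core w _ _ FT-v FT-w)

  u∈core⇒a≡b : InCore T u → a ≡ b
  u∈core⇒a≡b u∈core = ≤-antisym (m+m*n≤n+n*m⇒m≤n a b (u∈core v _ _ FT-u FT-v)) b≤a
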